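{- There exists a finite graph $G$ such that $G$ is not isomorphic to the Kaneta–Yoshinaga graph $G(K)$ of any triangulation $K$, and such that for some $k,\ell$ the magnitude homology group $\mathrm{MH}_{k,\ell}(G)$ contains an element of order $2$.
   Context: All graphs are finite, undirected, with no loops and no multiple edges. For a graph $G$, $d(x,y)$ denotes the shortest-path distance (edges have length $1$; $\infty$ if no path). A $k$-path is a tuple $(x_0,\dots,x_k)$ of vertices with $x_i\neq x_{i+1}$ and $d(x_i,x_{i+1})<\infty$; its length is $\sum_{i} d(x_i,x_{i+1})$. $\mathrm{MC}_{k,\ell}(G)$ is the free abelian group on $k$-paths of length $\ell$, with differential $\partial=\sum_{i=1}^{k-1}(-1)^i\partial_i$, where $\partial_i$ deletes $x_i$ if the resulting tuple is a $(k-1)$-path of the same length $\ell$ and is $0$ otherwise; $\mathrm{MH}_{k,\ell}(G)=H_k(\mathrm{MC}_{*,\ell}(G))$. Kaneta–Yoshinaga construction: let $K$ be a simplicial complex of dimension $m$ in which every face is a face of some $m$-simplex (e.g. a triangulation of a manifold). Let $P(K)$ be its face poset (faces ordered by inclusion), and let $\widehat{P(K)}$ be obtained by adjoining a minimum element $\hat 0$ and a maximum element $\hat 1$ if not already present. $G(K)$ is the underlying undirected graph of the Hasse diagram of $\widehat{P(K)}$. -}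

module Defs where

open import Data.Nat using (ℕ; zero; suc; _+_; _≤_; _≡ᵇ_)
open import Data.Bool using (Bool; true; false; _∧_; _∨_; not; if_then_else_; T)
import Data.Bool as B
open import Data.Fin using (Fin; zero; suc; toℕ; inject₁; _≟_)
open import Data.Fin.Subset using (Subset; ∣_∣; _⊆_; Nonempty)
open import Data.Fin.Subset.Properties using (_⊆?_)
open import Data.Vec using (Vec; []; _∷_; removeAt)
open import Data.Vec.Properties using (≡-dec)
open import Data.Bool.ListAction using (any; all)
open import Data.List using (List; []; _∷_; filterᵇ; map; _++_; length; lookup; concatMap; allFin)
open import Data.List.Relation.Unary.All using (All)
open import Data.Maybe using (Maybe; just; nothing)
open import Data.Integer using (ℤ; _*_; -_; 1ℤ; 0ℤ) renaming (_+_ to _+ℤ_)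
open import Data.Product using (Σ; _×_; _,_; proj₂)
open import Data.Unit using (⊤)
open import Function.Bundles using (_↔_; Inverse)
open import Relation.Binary.PropositionalEquality using (_≡_)
open import Relation.Nullary using (¬_; yes; no; does)

AdjRel : ℕ → Set
AdjRel n = Fin n → Fin n → Bool

IsSimpleGraph : ∀ {n} → AdjRel n → Set
IsSimpleGraph adj = (∀ x y → adj x y ≡ adj y x) × (∀ x → adj x x ≡ false)

Isomorphic : ∀ {n m} → AdjRel n → AdjRel m → Set
Isomorphic {n} {m} a b =
  Σ (Fin n ↔ Fin m) λ φ → ∀ x y → a x y ≡ b (Inverse.to φ x) (Inverse.to φ y)

anyFin : (n : ℕ) → (Fin n → Bool) → Bool
anyFin zero p = false
anyFin (suc n) p = p zero ∨ anyFin n (λ i → p (suc i))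

walkB : ∀ {n} → AdjRel n → ℕ → Fin n → Fin n → Bool
walkB adj zero x y = does (x ≟ y)
walkB {n} adj (suc m) x y = anyFin n (λ z → adj x z ∧ walkB adj m z y)

distSearch : ∀ {n} → AdjRel n → ℕ → ℕ → Fin n → Fin n → Maybe ℕ
distSearch adj m zero x y = nothing
distSearch adj m (suc f) x y =
  if walkB adj m x y then just m else distSearch adj (suc m) f x y

-- shortest-path distance d(x,y); nothing = ∞.
-- (A shortest walk, if any, has length < n, so searching 0..n-1 suffices.)
dist : ∀ {n} → AdjRel n → Fin n → Fin n → Maybe ℕ
dist {n} adj x y = distSearch adj 0 n x y

-- Magnitude chains.  A k-path is a Vec of k+1 vertices.

pathLen : ∀ {n k} → AdjRel n → Vec (Fin n) (suc k) → Maybe ℕ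
pathLen adj (x ∷ []) = just 0
pathLen adj (x ∷ y ∷ xs) with does (x ≟ y) | dist adj x y | pathLen adj (y ∷ xs)
... | false | just d | just l = just (d + l)
... | _ | _ | _ = nothing

hasLenB : ∀ {n k} → AdjRel n → ℕ → Vec (Fin n) (suc k) → Bool
hasLenB adj ℓ t with pathLen adj t
... | just l = l ≡ᵇ ℓ
... | nothing = false

-- a chain of degree k: formal ℤ-combination (finite list) of (k+1)-tuples
Chain : ℕ → ℕ → Set
Chain n k = List (ℤ × Vec (Fin n) (suc k))

ValidChain : ∀ {n k} → AdjRel n → ℕ → Chain n k → Set
ValidChain adj ℓ c = All (λ p → pathLen adj (proj₂ p) ≡ just ℓ) c

vecEqB : ∀ {n m} → Vec (Fin n) m → Vec (Fin n) m → Bool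
vecEqB s t = does (≡-dec _≟_ s t)

coeff : ∀ {n k} → Chain n k → Vec (Fin n) (suc k) → ℤ
coeff [] t = 0ℤ
coeff ((a , s) ∷ c) t = (if vecEqB s t then a else 0ℤ) +ℤ coeff c t

-- equality in the free abelian group
SameChain : ∀ {n k} → Chain n k → Chain n k → Set
SameChain c d = ∀ t → coeff c t ≡ coeff d t

sign : ℕ → ℤ
sign zero = 1ℤ
sign (suc i) = - sign i

-- (-1)^i ∂_i applied to a·(x_0,...,x_{k+1}), for interior index i = j+1 ∈ {1..k}
faceTerm : ∀ {n k} → AdjRel n → ℕ → ℤ → Vec (Fin n) (suc (suc k)) → Fin k
         → Chain n k
faceTerm adj ℓ a t j with removeAt t (suc (inject₁ j))
... | s = if hasLenB adj ℓ s then ((sign (suc (toℕ j)) * a , s) ∷ []) else []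

boundary : ∀ {n k} → AdjRel n → ℕ → Chain n (suc k) → Chain n k
boundary {n} {k} adj ℓ c =
  concatMap (λ { (a , t) → concatMap (faceTerm adj ℓ a t) (allFin k) }) c

IsCycle : ∀ {n} → AdjRel n → ℕ → (k : ℕ) → Chain n k → Set
IsCycle adj ℓ zero c = ⊤
IsCycle adj ℓ (suc k) c = SameChain (boundary adj ℓ c) []

IsBoundary : ∀ {n} → AdjRel n → ℕ → (k : ℕ) → Chain n k → Set
IsBoundary {n} adj ℓ k c =
  Σ (Chain n (suc k)) λ b → ValidChain adj ℓ b × SameChain c (boundary adj ℓ b)

double : ∀ {n k} → Chain n k → Chain n k
double c = map (λ { (a , t) → (a +ℤ a , t) }) c

HasOrder2Element : ∀ {n} → AdjRel n → ℕ → ℕ → Set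
HasOrder2Element {n} adj k ℓ =
  Σ (Chain n k) λ c →
    ValidChain adj ℓ c × IsCycle adj ℓ k c
    × ¬ IsBoundary adj ℓ k c × IsBoundary adj ℓ k (double c)

record PureComplex : Set where
  field
    v        : ℕ
    dim      : ℕ
    isFace   : Subset v → Bool
    faceNonempty : ∀ S → T (isFace S) → Nonempty S
    downClosed   : ∀ S S′ → T (isFace S) → S′ ⊆ S → Nonempty S′ → T (isFace S′)
    dimBound     : ∀ S → T (isFace S) → ∣ S ∣ ≤ suc dim
    pure         : ∀ S → T (isFace S) →
                   Σ (Subset v) λ F → T (isFace F) × S ⊆ F × ∣ F ∣ ≡ suc dim
    inhabited    : Σ (Subset v) λ S → T (isFace S)

allSubsets : (v : ℕ) → List (Subset v)
allSubsets zero = [] ∷ []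
allSubsets (suc v) = map (true ∷_) (allSubsets v) ++ map (false ∷_) (allSubsets v)

subB : ∀ {v} → Subset v → Subset v → Bool
subB S S′ = does (S ⊆? S′)

eqSubB : ∀ {v} → Subset v → Subset v → Bool
eqSubB S S′ = does (≡-dec B._≟_ S S′)

data Node (v : ℕ) : Set where
  bot  : Node v
  top  : Node v
  face : Subset v → Node v

ltB : ∀ {v} → Node v → Node v → Bool
ltB bot bot = false
ltB bot top = true
ltB bot (face _) = true
ltB top _ = false
ltB (face _) bot = false
ltB (face _) top = true
ltB (face S) (face S′) = subB S S′ ∧ not (eqSubB S S′)

module _ (K : PureComplex) where
  open PureComplex K

  faceList : List (Subset v)
  faceList = filterᵇ isFace (allSubsets v)

  hasMin : Bool
  hasMin = any (λ S → all (λ S′ → subB S S′) faceList) faceList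

  hasMax : Bool
  hasMax = any (λ S → all (λ S′ → subB S′ S) faceList) faceList

  nodes : List (Node v)
  nodes = (if hasMin then [] else bot ∷ [])
          ++ map face faceList
          ++ (if hasMax then [] else top ∷ [])

  coversB : Node v → Node v → Bool
  coversB a b = ltB a b ∧ not (any (λ c → ltB a c ∧ ltB c b) nodes)

  GK : AdjRel (length nodes)
  GK i j = coversB (lookup nodes i) (lookup nodes j)
           ∨ coversB (lookup nodes j) (lookup nodes i)

-- Γ is the Hasse diagram of the bounded face poset of the hemicube (the cell structure of ℝP²
-- with 4 vertices, 6 edges and 3 squares) with one extra vertex joined to the square 11 and
-- the top 14.  Hasse diagrams are triangle-free, since any orientation of a triangle contains
-- a chain a < m < b that the edge a–b would have to skip; so the triangle 11–14–15 shows that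
-- Γ is no G(K).  Mirroring the 2-torsion of H₁(ℝP²), the 3-chain c of 0 ⇝ 14 paths in MC₃,₄(Γ)
-- is a cycle with 2c = ∂b.  Pairing with the cochain that is 1 on the paths in W is even on
-- every boundary but odd on c.  Evenness is checked generator by generator: a 4-path of
-- length 4 is a walk, its interior faces keep its first vertex, so only the finitely many
-- walks out of 0 matter.

module Submission where

open import Defs
open import Data.Bool using (Bool; true; false; T; not; _∧_; _∨_; if_then_else_)
open import Data.Bool.Properties using (T-∧; T-∨; ∨-comm)
import Data.Bool as Bool
open import Data.Bool.ListAction using (any; all)
open import Data.Empty using (⊥; ⊥-elim)
open import Data.Fin using (Fin; zero; suc; toℕ; inject₁; #_; _≟_)
import Data.Fin.Properties as Fin
open import Data.Fin.Subset using (Subset; _⊆_)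
open import Data.Fin.Subset.Properties using (_⊆?_; ⊆-trans; ⊆-antisym)
open import Data.Integer using (ℤ; 0ℤ; 1ℤ; -1ℤ; _+_; _*_)
import Data.Integer as ℤ
import Data.Integer.Properties as ℤ
open import Data.Integer.Divisibility.Signed using (_∣_; divides; _∣?_; ∣m∣n⇒∣m+n; ∣n⇒∣m*n)
open import Data.Integer.Tactic.RingSolver using (solve-∀)
open import Algebra.Properties.CommutativeSemigroup ℤ.+-commutativeSemigroup using (interchange)
open import Data.List using (List; []; _∷_; _++_; map; concatMap; allFin; foldr)
open import Data.List.Membership.Propositional using (_∈_; _∉_)
open import Data.List.Membership.Propositional.Properties using (∈-lookup; ∈-++⁺ˡ; ∈-++⁺ʳ; ∈-allFin)
open import Data.List.Relation.Unary.All as All using (All; []; _∷_)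
open import Data.List.Relation.Unary.All.Properties using (all⁺)
open import Data.List.Relation.Unary.Any as Any using (here; there; any?)
open import Data.List.Relation.Unary.Any.Properties using (any⁺)
open import Data.Maybe using (just; nothing)
open import Data.Maybe.Properties using (just-injective)
import Data.Maybe.Properties as Maybe
open import Data.Nat using (ℕ; zero; suc; _≤_; z≤n; s≤s; _≡ᵇ_)
import Data.Nat as ℕ
import Data.Nat.Properties as ℕ
open import Data.Product using (Σ; ∃; ∃₂; _×_; _,_; proj₁; proj₂)
open import Data.Sum using (_⊎_; inj₁; inj₂)
open import Data.Vec using (Vec; []; _∷_; head; removeAt)
open import Data.Vec.Properties using (≡-dec)
open import Data.Vec.Relation.Unary.Linked using (Linked; []; [-]; _∷_)
open import Function using (_∘_; Equivalence; Inverse)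
open import Relation.Binary.PropositionalEquality
  using (_≡_; _≢_; refl; sym; trans; cong; cong₂; subst; module ≡-Reasoning)
open import Relation.Nullary using (¬_; Dec; yes; no; does)
open import Relation.Nullary.Decidable using (from-yes; from-no)

T-does : ∀ {P : Set} (p? : Dec P) → T (does p?) → P
T-does (yes p) _ = p

T-not-does : ∀ {P : Set} (p? : Dec P) → T (not (does p?)) → ¬ P
T-not-does (no ¬p) _ = ¬p

T-not⇒¬T : ∀ {b} → T (not b) → ¬ T b
T-not⇒¬T {false} _ ()

ltB-face⁻ : ∀ {v} (S S′ : Subset v) → T (ltB (face S) (face S′)) → S ⊆ S′ × S ≢ S′
ltB-face⁻ S S′ lt =
  let S⊆S′ , S≢S′ = Equivalence.to T-∧ lt
  in T-does (S ⊆? S′) S⊆S′ , T-not-does (≡-dec Bool._≟_ S S′) S≢S′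

ltB-face⁺ : ∀ {v} (S S′ : Subset v) → S ⊆ S′ → S ≢ S′ → T (ltB (face S) (face S′))
ltB-face⁺ S S′ S⊆S′ S≢S′ with S ⊆? S′ | ≡-dec Bool._≟_ S S′
... | yes _ | no _  = _
... | no S⊈S′ | _   = S⊈S′ S⊆S′
... | yes _ | yes S≡S′ = S≢S′ S≡S′

ltB-irrefl : ∀ {v} (a : Node v) → ¬ T (ltB a a)
ltB-irrefl (face S) lt = proj₂ (ltB-face⁻ S S lt) refl

ltB-trans : ∀ {v} {a b c : Node v} → T (ltB a b) → T (ltB b c) → T (ltB a c)
ltB-trans {a = bot} {face _} {top} _ _ = _
ltB-trans {a = bot} {face _} {face _} _ _ = _
ltB-trans {a = face _} {face _} {top} _ _ = _
ltB-trans {a = face S} {face S′} {face S″} S<S′ S′<S″ =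
  ltB-face⁺ S S″ (⊆-trans S⊆S′ S′⊆S″) λ { refl → S′≢S″ (⊆-antisym S′⊆S″ S⊆S′) }
  where
  S⊆S′ = proj₁ (ltB-face⁻ S S′ S<S′)
  S′⊆S″ = proj₁ (ltB-face⁻ S′ S″ S′<S″)
  S′≢S″ = proj₂ (ltB-face⁻ S′ S″ S′<S″)
ltB-trans {a = bot} {top} {c} _ ()
ltB-trans {a = face _} {top} {c} _ ()
ltB-trans {a = bot} {face _} {bot} _ ()
ltB-trans {a = face _} {face _} {bot} _ ()
ltB-trans {a = bot} {bot} () _
ltB-trans {a = face _} {bot} () _

module Hasse {A : Set} (lt : A → A → Bool) (xs : List A) where

  covers : A → A → Bool
  covers a b = lt a b ∧ not (any (λ c → lt a c ∧ lt c b) xs)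

  edge : A → A → Bool
  edge a b = covers a b ∨ covers b a

  edge-sym : ∀ {a b} → T (edge a b) → T (edge b a)
  edge-sym {a} {b} = subst T (∨-comm (covers a b) (covers b a))

  edge⇒comparable : ∀ {a b} → T (edge a b) → T (lt a b) ⊎ T (lt b a)
  edge⇒comparable e with Equivalence.to T-∨ e
  ... | inj₁ ab = inj₁ (proj₁ (Equivalence.to T-∧ ab))
  ... | inj₂ ba = inj₂ (proj₁ (Equivalence.to T-∧ ba))

  module _ (lt-irrefl : ∀ a → ¬ T (lt a a))
           (lt-trans : ∀ {a b c} → T (lt a b) → T (lt b c) → T (lt a c)) where

    no-edge-across : ∀ {a m b} → T (lt a m) → T (lt m b) → m ∈ xs → ¬ T (edge a b)
    no-edge-across {a} a<m m<b m∈xs e with Equivalence.to T-∨ e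
    ... | inj₁ ab = T-not⇒¬T (proj₂ (Equivalence.to T-∧ ab))
                      (any⁺ _ (Any.map (λ { refl → Equivalence.from T-∧ (a<m , m<b) }) m∈xs))
    ... | inj₂ ba = lt-irrefl a (lt-trans (lt-trans a<m m<b) (proj₁ (Equivalence.to T-∧ ba)))

    triangle-free : ∀ {a b c} → a ∈ xs → b ∈ xs → c ∈ xs →
                    T (edge a b) → T (edge b c) → T (edge a c) → ⊥
    triangle-free a∈ b∈ c∈ ab bc ac
      with edge⇒comparable ab | edge⇒comparable bc | edge⇒comparable ac
    ... | inj₁ a<b | inj₁ b<c | _        = no-edge-across a<b b<c b∈ ac
    ... | inj₁ a<b | inj₂ c<b | inj₁ a<c = no-edge-across a<c c<b c∈ ab
    ... | inj₁ a<b | inj₂ c<b | inj₂ c<a = no-edge-across c<a a<b a∈ (edge-sym bc)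
    ... | inj₂ b<a | inj₁ b<c | inj₁ a<c = no-edge-across b<a a<c a∈ bc
    ... | inj₂ b<a | inj₁ b<c | inj₂ c<a = no-edge-across b<c c<a c∈ (edge-sym ab)
    ... | inj₂ b<a | inj₂ c<b | _        = no-edge-across c<b b<a b∈ (edge-sym ac)

HasTriangle : ∀ {n} → AdjRel n → Set
HasTriangle {n} adj =
  Σ (Fin n) λ x → Σ (Fin n) λ y → Σ (Fin n) λ z → T (adj x y) × T (adj y z) × T (adj x z)

Isomorphic-HasTriangle : ∀ {n m} {a : AdjRel n} {b : AdjRel m} →
                         Isomorphic a b → HasTriangle a → HasTriangle b
Isomorphic-HasTriangle (φ , pres) (x , y , z , xy , yz , xz) =
  to x , to y , to z , subst T (pres x y) xy , subst T (pres y z) yz , subst T (pres x z) xz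
  where to = Inverse.to φ

-- GK K unfolds to Hasse.edge ltB (nodes K) on the nodes looked up at its arguments.
GK-triangle-free : (K : PureComplex) → ¬ HasTriangle (GK K)
GK-triangle-free K (i , j , k , ij , jk , ik) =
  Hasse.triangle-free ltB (nodes K) ltB-irrefl (λ {a b c} → ltB-trans {a = a} {b} {c})
    (∈-lookup i) (∈-lookup j) (∈-lookup k) ij jk ik

m+n≡1+o⇒m≡1×n≡o : ∀ {m n o} → 1 ≤ m → o ≤ n → m ℕ.+ n ≡ suc o → m ≡ 1 × n ≡ o
m+n≡1+o⇒m≡1×n≡o {suc m} {n} (s≤s _) o≤n eq
  with ℕ.n≤0⇒n≡0 (ℕ.+-cancelʳ-≤ n m 0 (subst (_≤ n) (sym (ℕ.suc-injective eq)) o≤n))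
... | refl = refl , ℕ.suc-injective eq

anyFin-witness : ∀ m (p : Fin m → Bool) → T (anyFin m p) → ∃ λ i → T (p i)
anyFin-witness (suc m) p h with Equivalence.to T-∨ h
... | inj₁ p0 = zero , p0
... | inj₂ ps = let i , pi = anyFin-witness m (p ∘ suc) ps in suc i , pi

Walk : ∀ {n m} → AdjRel n → Vec (Fin n) m → Set
Walk adj = Linked (λ x y → T (adj x y))

module _ {n} (adj : AdjRel n) where

  walkB-one⇒adj : ∀ {x y} → T (walkB adj 1 x y) → T (adj x y)
  walkB-one⇒adj {y = y} h with anyFin-witness n _ h
  ... | z , h′ with Equivalence.to T-∧ h′
  ... | xz , zy with T-does (z ≟ y) zy
  ... | refl = xz

  distSearch-walkB : ∀ m f {x y d} → distSearch adj m f x y ≡ just d → T (walkB adj d x y)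
  distSearch-walkB m (suc f) {x} {y} e with walkB adj m x y in w
  distSearch-walkB m (suc f) refl | true = subst T (sym w) _
  ... | false = distSearch-walkB (suc m) f e

  dist-positive : ∀ {x y d} → x ≢ y → dist adj x y ≡ just d → 1 ≤ d
  dist-positive {x} {y} {zero} x≢y e = ⊥-elim (x≢y (T-does (x ≟ y) (distSearch-walkB 0 n e)))
  dist-positive {d = suc d} _ _ = s≤s z≤n

  dist-one⇒adj : ∀ {x y} → dist adj x y ≡ just 1 → T (adj x y)
  dist-one⇒adj e = walkB-one⇒adj (distSearch-walkB 0 n e)

  pathLen-∷ : ∀ {k x y L} {xs : Vec (Fin n) k} → pathLen adj (x ∷ y ∷ xs) ≡ just L →
              ∃₂ λ d l → x ≢ y × dist adj x y ≡ just d × pathLen adj (y ∷ xs) ≡ just l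
                       × d ℕ.+ l ≡ L
  pathLen-∷ {x = x} {y} {xs = xs} e with x ≟ y | dist adj x y | pathLen adj (y ∷ xs)
  pathLen-∷ e | no x≢y | just d | just l = d , l , x≢y , refl , refl , just-injective e
  pathLen-∷ () | no _ | just _ | nothing
  pathLen-∷ () | no _ | nothing | _
  pathLen-∷ () | yes _ | _ | _

  pathLen-≥ : ∀ {k l} (t : Vec (Fin n) (suc k)) → pathLen adj t ≡ just l → k ≤ l
  pathLen-≥ (x ∷ []) _ = z≤n
  pathLen-≥ (x ∷ y ∷ xs) e with pathLen-∷ {xs = xs} e
  ... | d , l , x≢y , dxy , e′ , refl = ℕ.+-mono-≤ (dist-positive x≢y dxy) (pathLen-≥ (y ∷ xs) e′)

  pathLen-tight⇒Walk : ∀ {k} (t : Vec (Fin n) (suc k)) → pathLen adj t ≡ just k → Walk adj t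
  pathLen-tight⇒Walk (x ∷ []) _ = [-]
  pathLen-tight⇒Walk (x ∷ y ∷ xs) e with pathLen-∷ {xs = xs} e
  ... | d , l , x≢y , dxy , e′ , d+l≡1+k
    with m+n≡1+o⇒m≡1×n≡o (dist-positive x≢y dxy) (pathLen-≥ (y ∷ xs) e′) d+l≡1+k
  ... | refl , refl = dist-one⇒adj dxy ∷ pathLen-tight⇒Walk (y ∷ xs) e′

module _ {n k : ℕ} where

  support : Chain n k → List (Vec (Fin n) (suc k))
  support = map proj₂

  coeff-++ : ∀ (c d : Chain n k) t → coeff (c ++ d) t ≡ coeff c t + coeff d t
  coeff-++ [] d t = sym (ℤ.+-identityˡ (coeff d t))
  coeff-++ ((a , s) ∷ c) d t =
    trans (cong (h +_) (coeff-++ c d t)) (sym (ℤ.+-assoc h (coeff c t) (coeff d t)))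
    where h = if vecEqB s t then a else 0ℤ

  coeff-∉support : ∀ (c : Chain n k) {t} → t ∉ support c → coeff c t ≡ 0ℤ
  coeff-∉support [] _ = refl
  coeff-∉support ((a , s) ∷ c) {t} t∉ with ≡-dec _≟_ s t
  ... | yes refl = ⊥-elim (t∉ (here refl))
  ... | no _ = trans (ℤ.+-identityˡ (coeff c t)) (coeff-∉support c (t∉ ∘ there))

  validChain? : (adj : AdjRel n) (ℓ : ℕ) (c : Chain n k) → Dec (ValidChain adj ℓ c)
  validChain? adj ℓ = All.all? (λ (_ , t) → Maybe.≡-dec ℕ._≟_ (pathLen adj t) (just ℓ))

  sameChainᵇ : Chain n k → Chain n k → Bool
  sameChainᵇ c d = all (λ t → does (coeff c t ℤ.≟ coeff d t)) (support c ++ support d)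

  sameChainᵇ-sound : ∀ c d → T (sameChainᵇ c d) → SameChain c d
  sameChainᵇ-sound c d h t with any? (≡-dec _≟_ t) (support c ++ support d)
  ... | yes t∈ = T-does (coeff c t ℤ.≟ coeff d t) (All.lookup (all⁺ _ _ h) t∈)
  ... | no t∉ = trans (coeff-∉support c (t∉ ∘ ∈-++⁺ˡ))
                      (sym (coeff-∉support d (t∉ ∘ ∈-++⁺ʳ (support c))))

  -- The value on c of the cochain that is 1 on each tuple of W.
  weight : List (Vec (Fin n) (suc k)) → Chain n k → ℤ
  weight W c = foldr (λ w r → coeff c w + r) 0ℤ W

  weight-cong : ∀ W c d → SameChain c d → weight W c ≡ weight W d
  weight-cong [] c d _ = refl
  weight-cong (w ∷ W) c d c≈d = cong₂ _+_ (c≈d w) (weight-cong W c d c≈d)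

  weight-++ : ∀ W c d → weight W (c ++ d) ≡ weight W c + weight W d
  weight-++ [] c d = refl
  weight-++ (w ∷ W) c d =
    trans (cong₂ _+_ (coeff-++ c d w) (weight-++ W c d))
          (interchange (coeff c w) (coeff d w) (weight W c) (weight W d))

  weight-* : ∀ W a c d → (∀ w → coeff c w ≡ a * coeff d w) → weight W c ≡ a * weight W d
  weight-* [] a c d _ = sym (ℤ.*-zeroʳ a)
  weight-* (w ∷ W) a c d c≈ad =
    trans (cong₂ _+_ (c≈ad w) (weight-* W a c d c≈ad)) (sym (ℤ.*-distribˡ-+ a _ _))

  weight-zero : ∀ W c → All (λ w → coeff c w ≡ 0ℤ) W → weight W c ≡ 0ℤ
  weight-zero [] c [] = refl
  weight-zero (w ∷ W) c (z ∷ zs) = cong₂ _+_ z (weight-zero W c zs)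

module _ {n k : ℕ} (adj : AdjRel n) (ℓ : ℕ) where

  generatorBoundary : Vec (Fin n) (suc (suc k)) → Chain n k
  generatorBoundary t = concatMap (faceTerm adj ℓ 1ℤ t) (allFin k)

  coeff-faceTerm : ∀ a (t : Vec (Fin n) (suc (suc k))) j w →
                   coeff (faceTerm adj ℓ a t j) w ≡ a * coeff (faceTerm adj ℓ 1ℤ t j) w
  coeff-faceTerm a t j w with hasLenB adj ℓ (removeAt t (suc (inject₁ j)))
  ... | false = sym (ℤ.*-zeroʳ a)
  ... | true with vecEqB (removeAt t (suc (inject₁ j))) w
  ...   | true = sign-scale (sign (suc (toℕ j))) a
    where
    sign-scale : ∀ σ a → σ * a + 0ℤ ≡ a * (σ * 1ℤ + 0ℤ)
    sign-scale = solve-∀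
  ...   | false = sym (ℤ.*-zeroʳ a)

  coeff-faces : ∀ a (t : Vec (Fin n) (suc (suc k))) js w →
                coeff (concatMap (faceTerm adj ℓ a t) js) w
                  ≡ a * coeff (concatMap (faceTerm adj ℓ 1ℤ t) js) w
  coeff-faces a t [] w = sym (ℤ.*-zeroʳ a)
  coeff-faces a t (j ∷ js) w = begin
    coeff (∂ᵢ a j ++ ∂ a) w
      ≡⟨ coeff-++ (∂ᵢ a j) (∂ a) w ⟩
    coeff (∂ᵢ a j) w + coeff (∂ a) w
      ≡⟨ cong₂ _+_ (coeff-faceTerm a t j w) (coeff-faces a t js w) ⟩
    a * coeff (∂ᵢ 1ℤ j) w + a * coeff (∂ 1ℤ) w
      ≡⟨ ℤ.*-distribˡ-+ a _ _ ⟨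
    a * (coeff (∂ᵢ 1ℤ j) w + coeff (∂ 1ℤ) w)
      ≡⟨ cong (a *_) (coeff-++ (∂ᵢ 1ℤ j) (∂ 1ℤ) w) ⟨
    a * coeff (∂ᵢ 1ℤ j ++ ∂ 1ℤ) w
      ∎
    where
    open ≡-Reasoning
    ∂ᵢ : ℤ → Fin k → Chain n k
    ∂ᵢ b = faceTerm adj ℓ b t
    ∂ : ℤ → Chain n k
    ∂ b = concatMap (∂ᵢ b) js

  coeff-faces-head : ∀ a (t : Vec (Fin n) (suc (suc k))) js w → head w ≢ head t →
                     coeff (concatMap (faceTerm adj ℓ a t) js) w ≡ 0ℤ
  coeff-faces-head a t [] w _ = refl
  coeff-faces-head a t@(_ ∷ _ ∷ _) (j ∷ js) w w≢t =
    trans (coeff-++ (faceTerm adj ℓ a t j) _ w)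
          (cong₂ _+_ coeff-face (coeff-faces-head a t js w w≢t))
    where
    coeff-face : coeff (faceTerm adj ℓ a t j) w ≡ 0ℤ
    coeff-face with hasLenB adj ℓ (removeAt t (suc (inject₁ j)))
    ... | false = refl
    ... | true with ≡-dec _≟_ (removeAt t (suc (inject₁ j))) w
    ...   | yes refl = ⊥-elim (w≢t refl)
    ...   | no _ = refl

  Mod2Cocycle : List (Vec (Fin n) (suc k)) → Set
  Mod2Cocycle W = ∀ t → pathLen adj t ≡ just ℓ → ℤ.+ 2 ∣ weight W (generatorBoundary t)

  weight-boundary-even : ∀ W → Mod2Cocycle W → ∀ b → ValidChain adj ℓ b →
                         ℤ.+ 2 ∣ weight W (boundary adj ℓ b)
  weight-boundary-even W _ [] [] =
    subst (ℤ.+ 2 ∣_) (sym (weight-zero W [] (All.universal (λ _ → refl) W))) (divides 0ℤ refl)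
  weight-boundary-even W cocycle ((a , t) ∷ b) (t-valid ∷ b-valid) =
    subst (ℤ.+ 2 ∣_) (sym weight-∂)
      (∣m∣n⇒∣m+n (∣n⇒∣m*n a (cocycle t t-valid)) (weight-boundary-even W cocycle b b-valid))
    where
    weight-∂ : weight W (boundary adj ℓ ((a , t) ∷ b))
             ≡ a * weight W (generatorBoundary t) + weight W (boundary adj ℓ b)
    weight-∂ = trans (weight-++ W faces (boundary adj ℓ b))
                     (cong (_+ weight W (boundary adj ℓ b))
                           (weight-* W a faces (generatorBoundary t) (coeff-faces a t (allFin k))))
      where faces = concatMap (faceTerm adj ℓ a t) (allFin k)

  Mod2Cocycle-¬IsBoundary : ∀ W c → Mod2Cocycle W → ¬ (ℤ.+ 2 ∣ weight W c) →
                            ¬ IsBoundary adj ℓ k c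
  Mod2Cocycle-¬IsBoundary W c cocycle odd (b , b-valid , c≈∂b) =
    odd (subst (ℤ.+ 2 ∣_) (sym (weight-cong W c (boundary adj ℓ b) c≈∂b))
                (weight-boundary-even W cocycle b b-valid))

  weight-generatorBoundary-head : ∀ {v} W t → All (λ w → head w ≡ v) W → head t ≢ v →
                                  weight W (generatorBoundary t) ≡ 0ℤ
  weight-generatorBoundary-head {v} W t heads t≢v =
    weight-zero W (generatorBoundary t) (All.map vanishes heads)
    where
    vanishes : ∀ {w} → head w ≡ v → coeff (generatorBoundary t) w ≡ 0ℤ
    vanishes {w} w≡v = coeff-faces-head 1ℤ t (allFin k) w (λ w≡t → t≢v (trans (sym w≡t) w≡v))

Mod2Cocycle-fromWalks : ∀ {n k} (adj : AdjRel n) {v} (W : List (Vec (Fin n) (suc k))) →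
  All (λ w → head w ≡ v) W →
  (∀ {xs} → Walk adj (v ∷ xs) → ℤ.+ 2 ∣ weight W (generatorBoundary adj (suc k) (v ∷ xs))) →
  Mod2Cocycle adj (suc k) W
Mod2Cocycle-fromWalks adj {v} W heads walks (x ∷ xs) tight with x ≟ v
... | yes refl = walks (pathLen-tight⇒Walk adj (x ∷ xs) tight)
... | no x≢v = subst (ℤ.+ 2 ∣_) (sym (weight-generatorBoundary-head adj _ W (x ∷ xs) heads x≢v))
                     (divides 0ℤ refl)

allWalksᵇ : ∀ {n} → AdjRel n → (k : ℕ) → Fin n → (Vec (Fin n) (suc k) → Bool) → Bool
allWalksᵇ adj zero x p = p (x ∷ [])
allWalksᵇ {n} adj (suc k) x p =
  all (λ y → not (adj x y) ∨ allWalksᵇ adj k y (p ∘ (x ∷_))) (allFin n)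

allWalksᵇ-sound : ∀ {n} (adj : AdjRel n) k {x} p → T (allWalksᵇ adj k x p) →
                  ∀ {xs} → Walk adj (x ∷ xs) → T (p (x ∷ xs))
allWalksᵇ-sound adj zero p h {[]} _ = h
allWalksᵇ-sound {n} adj (suc k) {x} p h {y ∷ ys} (xy ∷ walk)
  with Equivalence.to T-∨ (All.lookup (all⁺ _ (allFin n) h) (∈-allFin y))
... | inj₁ ¬xy = ⊥-elim (T-not⇒¬T ¬xy xy)
... | inj₂ rest = allWalksᵇ-sound adj k (p ∘ (x ∷_)) rest walk

-- Vertices: 0 = ∅, 1–4 the vertices, 5–10 the edges and 11–13 the squares of the hemicube,
-- 14 = the whole complex; vertex 15 is an extra apex over the edge 11–14.
edges : List (ℕ × ℕ)
edges = (0 , 1) ∷ (0 , 2) ∷ (0 , 3) ∷ (0 , 4)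
  ∷ (1 , 5) ∷ (1 , 6) ∷ (1 , 9) ∷ (2 , 5) ∷ (2 , 7) ∷ (2 , 10)
  ∷ (3 , 6) ∷ (3 , 8) ∷ (3 , 10) ∷ (4 , 7) ∷ (4 , 8) ∷ (4 , 9)
  ∷ (5 , 11) ∷ (5 , 12) ∷ (6 , 11) ∷ (6 , 13) ∷ (7 , 11) ∷ (7 , 13)
  ∷ (8 , 11) ∷ (8 , 12) ∷ (9 , 12) ∷ (9 , 13) ∷ (10 , 12) ∷ (10 , 13)
  ∷ (11 , 14) ∷ (12 , 14) ∷ (13 , 14)
  ∷ (11 , 15) ∷ (14 , 15) ∷ []

isEdge : ℕ → ℕ → Bool
isEdge x y = any (λ (a , b) → (x ≡ᵇ a) ∧ (y ≡ᵇ b)) edges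

Γ : AdjRel 16
Γ x y = isEdge (toℕ x) (toℕ y) ∨ isEdge (toℕ y) (toℕ x)

Γ-simple : IsSimpleGraph Γ
Γ-simple = (λ x y → ∨-comm (isEdge (toℕ x) (toℕ y)) _)
         , from-yes (Fin.all? λ x → Γ x x Bool.≟ false)

Γ-triangle : HasTriangle Γ
Γ-triangle = # 11 , # 14 , # 15 , _ , _ , _

c : Chain 16 3
c = (1ℤ , # 0 ∷ # 2 ∷ # 7 ∷ # 14 ∷ [])
  ∷ (-1ℤ , # 0 ∷ # 2 ∷ # 10 ∷ # 14 ∷ [])
  ∷ (-1ℤ , # 0 ∷ # 3 ∷ # 8 ∷ # 14 ∷ [])
  ∷ (1ℤ , # 0 ∷ # 3 ∷ # 10 ∷ # 14 ∷ [])
  ∷ (-1ℤ , # 0 ∷ # 4 ∷ # 7 ∷ # 14 ∷ [])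
  ∷ (1ℤ , # 0 ∷ # 4 ∷ # 8 ∷ # 14 ∷ []) ∷ []

b : Chain 16 4
b = (-1ℤ , # 0 ∷ # 1 ∷ # 5 ∷ # 11 ∷ # 14 ∷ [])
  ∷ (1ℤ , # 0 ∷ # 1 ∷ # 5 ∷ # 12 ∷ # 14 ∷ [])
  ∷ (1ℤ , # 0 ∷ # 1 ∷ # 6 ∷ # 11 ∷ # 14 ∷ [])
  ∷ (-1ℤ , # 0 ∷ # 1 ∷ # 6 ∷ # 13 ∷ # 14 ∷ [])
  ∷ (-1ℤ , # 0 ∷ # 1 ∷ # 9 ∷ # 12 ∷ # 14 ∷ [])
  ∷ (1ℤ , # 0 ∷ # 1 ∷ # 9 ∷ # 13 ∷ # 14 ∷ [])
  ∷ (1ℤ , # 0 ∷ # 2 ∷ # 5 ∷ # 11 ∷ # 14 ∷ [])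
  ∷ (-1ℤ , # 0 ∷ # 2 ∷ # 5 ∷ # 12 ∷ # 14 ∷ [])
  ∷ (-1ℤ , # 0 ∷ # 2 ∷ # 7 ∷ # 11 ∷ # 14 ∷ [])
  ∷ (-1ℤ , # 0 ∷ # 2 ∷ # 7 ∷ # 13 ∷ # 14 ∷ [])
  ∷ (1ℤ , # 0 ∷ # 2 ∷ # 10 ∷ # 12 ∷ # 14 ∷ [])
  ∷ (1ℤ , # 0 ∷ # 2 ∷ # 10 ∷ # 13 ∷ # 14 ∷ [])
  ∷ (-1ℤ , # 0 ∷ # 3 ∷ # 6 ∷ # 11 ∷ # 14 ∷ [])
  ∷ (1ℤ , # 0 ∷ # 3 ∷ # 6 ∷ # 13 ∷ # 14 ∷ [])
  ∷ (1ℤ , # 0 ∷ # 3 ∷ # 8 ∷ # 11 ∷ # 14 ∷ [])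
  ∷ (1ℤ , # 0 ∷ # 3 ∷ # 8 ∷ # 12 ∷ # 14 ∷ [])
  ∷ (-1ℤ , # 0 ∷ # 3 ∷ # 10 ∷ # 12 ∷ # 14 ∷ [])
  ∷ (-1ℤ , # 0 ∷ # 3 ∷ # 10 ∷ # 13 ∷ # 14 ∷ [])
  ∷ (1ℤ , # 0 ∷ # 4 ∷ # 7 ∷ # 11 ∷ # 14 ∷ [])
  ∷ (1ℤ , # 0 ∷ # 4 ∷ # 7 ∷ # 13 ∷ # 14 ∷ [])
  ∷ (-1ℤ , # 0 ∷ # 4 ∷ # 8 ∷ # 11 ∷ # 14 ∷ [])
  ∷ (-1ℤ , # 0 ∷ # 4 ∷ # 8 ∷ # 12 ∷ # 14 ∷ [])
  ∷ (1ℤ , # 0 ∷ # 4 ∷ # 9 ∷ # 12 ∷ # 14 ∷ [])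
  ∷ (-1ℤ , # 0 ∷ # 4 ∷ # 9 ∷ # 13 ∷ # 14 ∷ []) ∷ []

-- (0, 4, 8, 14) is the only path of c in W.
W : List (Vec (Fin 16) 4)
W = (# 0 ∷ # 1 ∷ # 5 ∷ # 14 ∷ [])
  ∷ (# 0 ∷ # 2 ∷ # 11 ∷ # 14 ∷ [])
  ∷ (# 0 ∷ # 2 ∷ # 12 ∷ # 14 ∷ [])
  ∷ (# 0 ∷ # 3 ∷ # 12 ∷ # 14 ∷ [])
  ∷ (# 0 ∷ # 4 ∷ # 8 ∷ # 14 ∷ [])
  ∷ (# 0 ∷ # 4 ∷ # 11 ∷ # 14 ∷ [])
  ∷ (# 0 ∷ # 5 ∷ # 11 ∷ # 14 ∷ [])
  ∷ (# 0 ∷ # 5 ∷ # 12 ∷ # 14 ∷ [])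
  ∷ (# 0 ∷ # 7 ∷ # 11 ∷ # 14 ∷ [])
  ∷ (# 0 ∷ # 8 ∷ # 12 ∷ # 14 ∷ [])
  ∷ (# 0 ∷ # 10 ∷ # 12 ∷ # 14 ∷ []) ∷ []

W-cocycle : Mod2Cocycle Γ 4 W
W-cocycle = Mod2Cocycle-fromWalks Γ {v = # 0} W (from-yes (All.all? (λ w → head w ≟ # 0) W))
  (λ walk → T-does (ℤ.+ 2 ∣? _) (allWalksᵇ-sound Γ 4 even? _ walk))
  where
  even? : Vec (Fin 16) 5 → Bool
  even? t = does (ℤ.+ 2 ∣? weight W (generatorBoundary Γ 4 t))

proposition3p9 :
    Σ ℕ λ n → Σ (AdjRel n) λ G →
      IsSimpleGraph G
      × ((K : PureComplex) → ¬ Isomorphic G (GK K))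
      × (Σ ℕ λ k → Σ ℕ λ ℓ → HasOrder2Element G k ℓ)
proposition3p9 =
  16 , Γ , Γ-simple ,
  (λ K iso → GK-triangle-free K (Isomorphic-HasTriangle iso Γ-triangle)) ,
  3 , 4 , c , from-yes (validChain? Γ 4 c) ,
  sameChainᵇ-sound (boundary Γ 4 c) [] _ ,
  Mod2Cocycle-¬IsBoundary Γ 4 W c W-cocycle (from-no (ℤ.+ 2 ∣? weight W c)) ,
  (b , from-yes (validChain? Γ 4 b) , sameChainᵇ-sound (double c) (boundary Γ 4 b) _)
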